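{- Let $A$ be a residuated lattice, $M\in{\rm Max}(A)$ and $a\in A$. Then: (i) $a/Ds(A)\in M/Ds(A)$ iff $a\in M$; (ii) ${\rm Max}(A/Ds(A))=\{N/Ds(A)\mid N\in{\rm Max}(A)\}$; (iii) $a/Ds(A)\in{\rm Rad}(A)/Ds(A)$ iff $a\in{\rm Rad}(A)$; (iv) ${\rm Rad}(A/Ds(A))={\rm Rad}(A)/Ds(A)$; (v) ${\rm Max}(A)$ and ${\rm Max}(A/Ds(A))$, each with its Stone topology, are homeomorphic topological spaces.
   Context: A (commutative) residuated lattice is an algebra $(A,\vee,\wedge,\odot,\rightarrow,0,1)$ such that $(A,\vee,\wedge,0,1)$ is a bounded lattice, $(A,\odot,1)$ is a commutative monoid, and for all $a,b,c\in A$: $a\le b\rightarrow c$ iff $a\odot b\le c$. Write $\neg a=a\rightarrow 0$ and $a\leftrightarrow b=(a\rightarrow b)\wedge(b\rightarrow a)$. A filter of $A$ is a nonempty subset $F$ closed under $\odot$ and upward closed; it is proper if $F\ne A$; a maximal filter is a maximal element among the proper filters. ${\rm Max}(A)$ is the set of maximal filters and ${\rm Rad}(A)$ is the intersection of all maximal filters. $Ds(A)=\{a\in A\mid \neg a=0\}$ (a filter). For a filter $F$, $a\equiv b \pmod F$ iff $a\leftrightarrow b\in F$; this is a congruence, $A/F$ is the quotient residuated lattice with elements $a/F$, and for $X\subseteq A$, $X/F=\{x/F\mid x\in X\}$. The Stone topology on ${\rm Max}(A)$ is the topology whose open sets are $S_{\rm Max}(X)=\{M\in{\rm Max}(A)\mid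 X\not\subseteq M\}$ for $X\subseteq A$ (basis: $S_{\rm Max}(a)=\{M\in {\rm Max}(A)\mid a\notin M\}$, $a\in A$). -}

module Defs where

open import Level using (Level; suc; _⊔_)
open import Data.Product using (Σ; ∃; _×_; _,_; proj₁)
open import Relation.Nullary using (¬_)
open import Relation.Binary using (Rel; IsEquivalence)
open import Relation.Unary using (Pred; _⊆_)
open import Algebra.Core using (Op₂)
open import Algebra.Structures using (IsCommutativeMonoid)
open import Algebra.Lattice.Structures using (IsLattice)
open import Function.Bundles using (_⇔_)

-- The operations of a (commutative) residuated lattice, over a setoid
-- carrier.  No axioms: this is what quotients A/F are built from.
record RawRL (c : Level) : Set (suc c) where
  infix  4 _≈_
  infixr 7 _⊙_
  infixr 6 _∧_
  infixr 5 _∨_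
  infixr 4 _⇒_
  field
    Carrier : Set c
    _≈_     : Rel Carrier c
    _∨_ _∧_ _⊙_ _⇒_ : Op₂ Carrier
    0# 1#   : Carrier

  _≤_ : Rel Carrier c
  x ≤ y = (x ∧ y) ≈ x

  ¬′_ : Carrier → Carrier
  ¬′ a = a ⇒ 0#

  _⇔′_ : Op₂ Carrier
  a ⇔′ b = (a ⇒ b) ∧ (b ⇒ a)

record ResLattice (c : Level) : Set (suc c) where
  field
    raw : RawRL c
  open RawRL raw public
  field
    isLattice   : IsLattice _≈_ _∨_ _∧_
    0-least     : ∀ x → 0# ≤ x
    1-greatest  : ∀ x → x ≤ 1#
    ⊙-isCommutativeMonoid : IsCommutativeMonoid _≈_ _⊙_ 1#
    ⇒-cong      : ∀ {x y u v} → x ≈ y → u ≈ v → (x ⇒ u) ≈ (y ⇒ v)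
    residuation : ∀ a b d → (a ≤ (b ⇒ d) → (a ⊙ b) ≤ d) × ((a ⊙ b) ≤ d → a ≤ (b ⇒ d))

module _ {c : Level} (R : RawRL c) where
  open RawRL R

  record IsFilter (F : Pred Carrier c) : Set c where
    field
      nonempty : ∃ λ x → F x
      ⊙-closed : ∀ {x y} → F x → F y → F (x ⊙ y)
      up-closed : ∀ {x y} → x ≤ y → F x → F y

  IsProperFilter : Pred Carrier c → Set c
  IsProperFilter F = IsFilter F × ¬ (∀ x → F x)

  IsMaximal : Pred Carrier c → Set (suc c)
  IsMaximal F = IsProperFilter F × (∀ G → IsProperFilter G → F ⊆ G → G ⊆ F)

  Max : Set (suc c)
  Max = Σ (Pred Carrier c) IsMaximal

  Rad : Pred Carrier (suc c)
  Rad a = ∀ (M : Pred Carrier c) → IsMaximal M → M a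

  Ds : Pred Carrier c
  Ds a = (¬′ a) ≈ 0#

  _≡[_]_ : Carrier → Pred Carrier c → Carrier → Set c
  a ≡[ F ] b = F (a ⇔′ b)

  -- X/F = { x/F | x ∈ X }, as a subset of (the carrier of) A/F
  _/_ : ∀ {ℓ} → Pred Carrier ℓ → Pred Carrier c → Pred Carrier (c ⊔ ℓ)
  (X / F) z = ∃ λ x → X x × (x ≡[ F ] z)

  SMax : Pred Carrier c → Max → Set c
  SMax X M = ¬ (X ⊆ proj₁ M)

  -- open sets of the Stone topology are exactly the S_Max(X)
  IsOpen : (Max → Set c) → Set (suc c)
  IsOpen U = ∃ λ (X : Pred Carrier c) → ∀ M → U M ⇔ SMax X M

  _≐_ : Max → Max → Set c
  M ≐ N = ∀ x → proj₁ M x ⇔ proj₁ N x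

_/ₚ_ : ∀ {c} (R : RawRL c) → Pred (RawRL.Carrier R) c → RawRL c
R /ₚ F = record
  { Carrier = Carrier ; _≈_ = λ a b → _≡[_]_ R a F b
  ; _∨_ = _∨_ ; _∧_ = _∧_ ; _⊙_ = _⊙_ ; _⇒_ = _⇒_ ; 0# = 0# ; 1# = 1# }
  where open RawRL R

QuotDs : ∀ {c} → ResLattice c → RawRL c
QuotDs A = ResLattice.raw A /ₚ Ds (ResLattice.raw A)

record Homeomorphic {c : Level} (R₁ R₂ : RawRL c) : Set (suc c) where
  field
    to      : Max R₁ → Max R₂
    from    : Max R₂ → Max R₁
    to-cong   : ∀ {M N} → _≐_ R₁ M N → _≐_ R₂ (to M) (to N)
    from-cong : ∀ {M N} → _≐_ R₂ M N → _≐_ R₁ (from M) (from N)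
    from∘to : ∀ M → _≐_ R₁ (from (to M)) M
    to∘from : ∀ N → _≐_ R₂ (to (from N)) N
    to-continuous   : ∀ U → IsOpen R₂ U → IsOpen R₁ (λ M → U (to M))
    from-continuous : ∀ U → IsOpen R₁ U → IsOpen R₂ (λ N → U (from N))

module Submission where

-- Write D = Ds(A) and Q = A/Ds(A).  The quotient Q has the same
-- carrier and operations as A, only a coarser equality (congruence mod D), so
-- subsets of Q are subsets of A.  The whole proposition rests on two facts:
--
--   * a subset of A is a filter of Q  iff  it is a filter of A containing D;
--   * every maximal filter of A contains D (otherwise the filter generated by
--     M and D would be a strictly larger proper filter).
--
-- Together they show that Max(Q) and Max(A) consist of the very same subsets,
-- so Rad(Q) = Rad(A) and the identity map is a homeomorphism of the Stone
-- spaces (both topologies are given by the same sets S_Max(X)).  Finally, a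
-- subset X that is a union of classes mod D satisfies X/D = X; maximal filters
-- and Rad(A) are such unions, which yields (i)-(iv).

open import Level using (Level)
open import Data.Product using (∃; _×_; Σ; _,_; proj₁; proj₂)
open import Relation.Nullary using (¬_)
open import Relation.Unary using (Pred; _⊆_)
open import Axiom.ExcludedMiddle using (ExcludedMiddle)
open import Function.Bundles using (_⇔_; mk⇔; Equivalence)
import Function.Properties.Equivalence as ⇔
open import Algebra.Lattice.Bundles using (Lattice)
open import Algebra.Lattice.Structures using (IsLattice)
open import Algebra.Structures using (IsCommutativeMonoid)
import Algebra.Lattice.Properties.Lattice as LatticeProperties
open import Relation.Binary.Lattice using (MeetSemilattice)
open import Defs

IsMaximal-resp : ∀ {c} (R : RawRL c) {M N : Pred (RawRL.Carrier R) c} →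
                 (∀ x → M x ⇔ N x) → IsMaximal R M → IsMaximal R N
IsMaximal-resp R {M} {N} M⇔N ((M-filter , M-proper) , M-max) =
  (N-filter , λ N-total → M-proper (λ x → from (N-total x))) ,
  λ G G-proper N⊆G Gx → to (M-max G G-proper (λ Mx → N⊆G (to Mx)) Gx)
  where
  open IsFilter M-filter
  to : M ⊆ N
  to {x} = Equivalence.to (M⇔N x)
  from : N ⊆ M
  from {x} = Equivalence.from (M⇔N x)
  N-filter : IsFilter R N
  N-filter = record
    { nonempty  = proj₁ nonempty , to (proj₂ nonempty)
    ; ⊙-closed  = λ Nx Ny → to (⊙-closed (from Nx) (from Ny))
    ; up-closed = λ x≤y Nx → to (up-closed x≤y (from Nx)) }

module _ {c : Level} (A : ResLattice c) where
  open ResLattice A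
  open IsLattice isLattice using (refl; sym; trans)
  open IsCommutativeMonoid ⊙-isCommutativeMonoid
    using (assoc; comm; identityˡ; identityʳ; ∙-cong)

  private
    R : RawRL c
    R = raw
    Q : RawRL c
    Q = QuotDs A
    D : Pred Carrier c
    D = Ds R

  _≡D_ : Carrier → Carrier → Set c
  a ≡D b = D (a ⇔′ b)

  -- The order of Defs, x ≤ y := x ∧ y ≈ x, is the library's natural order of
  -- the ∧-semilattice read with ≈ flipped; we transfer its basic laws.
  private
    lattice : Lattice c c
    lattice = record { isLattice = isLattice }
    module Nat = MeetSemilattice
      (LatticeProperties.∧-orderTheoreticMeetSemilattice lattice)

  ≤-refl : ∀ x → x ≤ x
  ≤-refl x = sym Nat.refl

  ≤-trans : ∀ {x y z} → x ≤ y → y ≤ z → x ≤ z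
  ≤-trans x≤y y≤z = sym (Nat.trans (sym x≤y) (sym y≤z))

  ≈⇒≤ : ∀ {x y} → x ≈ y → x ≤ y
  ≈⇒≤ x≈y = sym (Nat.reflexive x≈y)

  x∧y≤x : ∀ {x y} → (x ∧ y) ≤ x
  x∧y≤x = sym (Nat.x∧y≤x _ _)

  x∧y≤y : ∀ {x y} → (x ∧ y) ≤ y
  x∧y≤y = sym (Nat.x∧y≤y _ _)

  ∧-greatest : ∀ {x y z} → x ≤ y → x ≤ z → x ≤ (y ∧ z)
  ∧-greatest x≤y x≤z = sym (Nat.∧-greatest (sym x≤y) (sym x≤z))

  ≤0⇒≈0 : ∀ {x} → x ≤ 0# → x ≈ 0#
  ≤0⇒≈0 x≤0 = Nat.antisym (sym x≤0) (sym (0-least _))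

  residual-elim : ∀ {a b d} → a ≤ (b ⇒ d) → (a ⊙ b) ≤ d
  residual-elim = proj₁ (residuation _ _ _)

  residual-intro : ∀ {a b d} → (a ⊙ b) ≤ d → a ≤ (b ⇒ d)
  residual-intro = proj₂ (residuation _ _ _)

  ⊙-monoˡ : ∀ {x y z} → x ≤ y → (x ⊙ z) ≤ (y ⊙ z)
  ⊙-monoˡ {y = y} {z} x≤y =
    residual-elim (≤-trans x≤y (residual-intro (≤-refl (y ⊙ z))))

  ⊙-mono : ∀ {x y u v} → x ≤ y → u ≤ v → (x ⊙ u) ≤ (y ⊙ v)
  ⊙-mono {y = y} {u} {v} x≤y u≤v =
    ≤-trans (⊙-monoˡ x≤y)
      (≤-trans (≈⇒≤ (comm y u)) (≤-trans (⊙-monoˡ u≤v) (≈⇒≤ (comm v y))))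

  modus-ponens : ∀ {x y} → (x ⊙ (x ⇒ y)) ≤ y
  modus-ponens {x} {y} =
    ≤-trans (≈⇒≤ (comm x (x ⇒ y))) (residual-elim (≤-refl (x ⇒ y)))

  ¬-antitone : ∀ {x y} → x ≤ y → (¬′ y) ≤ (¬′ x)
  ¬-antitone x≤y =
    residual-intro (≤-trans (⊙-mono (≤-refl _) x≤y) (residual-elim (≤-refl _)))

  module FilterProps {F : Pred Carrier c} (F-filter : IsFilter R F) where
    open IsFilter F-filter

    1∈F : F 1#
    1∈F = up-closed (1-greatest _) (proj₂ nonempty)

    F-mp : ∀ {x y} → F x → F (x ⇒ y) → F y
    F-mp Fx Fx⇒y = up-closed modus-ponens (⊙-closed Fx Fx⇒y)

    0∈F⇒total : F 0# → ∀ x → F x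
    0∈F⇒total F0 x = up-closed (0-least x) F0

  -- Ds(A) is a filter: upward closed since ¬ is antitone, and 1 ∈ Ds as ¬1 ≤ 0.
  Ds-up : ∀ {x y} → x ≤ y → D x → D y
  Ds-up x≤y Dx = ≤0⇒≈0 (≤-trans (¬-antitone x≤y) (≈⇒≤ Dx))

  1∈Ds : D 1#
  1∈Ds = ≤0⇒≈0 (≤-trans (≈⇒≤ (sym (identityʳ _))) (residual-elim (≤-refl _)))

  -- ¬(x⊙y) ⊙ x ≤ ¬y ≈ 0, hence ¬(x⊙y) ≤ ¬x ≈ 0.
  Ds-⊙ : ∀ {x y} → D x → D y → D (x ⊙ y)
  Ds-⊙ {x} {y} Dx Dy = ≤0⇒≈0 (≤-trans (residual-intro w⊙x≤0) (≈⇒≤ Dx))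
    where
    w = ¬′ (x ⊙ y)
    w⊙x≤0 : (w ⊙ x) ≤ 0#
    w⊙x≤0 = ≤-trans (residual-intro
      (≤-trans (≈⇒≤ (assoc w x y)) (residual-elim (≤-refl w)))) (≈⇒≤ Dy)

  Ds-isFilter : IsFilter R D
  Ds-isFilter = record
    { nonempty = 1# , 1∈Ds ; ⊙-closed = Ds-⊙ ; up-closed = Ds-up }

  ≈⇒≡D : ∀ {u v} → u ≈ v → u ≡D v
  ≈⇒≡D {u} {v} u≈v = Ds-up (∧-greatest
    (residual-intro (≈⇒≤ (trans (identityˡ u) u≈v)))
    (residual-intro (≈⇒≤ (trans (identityˡ v) (sym u≈v))))) 1∈Ds

  Ds⇒1≤Q : ∀ {d} → D d → RawRL._≤_ Q 1# d
  Ds⇒1≤Q {d} Dd = Ds-up (∧-greatest (residual-intro (1-greatest _))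
    (residual-intro (≤-trans (≈⇒≤ (identityʳ d)) (∧-greatest (1-greatest d) (≤-refl d))))) Dd

  Q-filter⇒filter : ∀ {F} → IsFilter Q F → IsFilter R F
  Q-filter⇒filter F-filter = record
    { nonempty  = nonempty
    ; ⊙-closed  = ⊙-closed
    ; up-closed = λ x≤y → up-closed (≈⇒≡D x≤y) }
    where open IsFilter F-filter

  Q-filter⊇Ds : ∀ {F} → IsFilter Q F → D ⊆ F
  Q-filter⊇Ds F-filter Dd = up-closed (Ds⇒1≤Q Dd) 1∈F
    where
    open IsFilter F-filter
    1∈F = up-closed (≈⇒≡D (1-greatest (proj₁ nonempty))) (proj₂ nonempty)

  filter⊇Ds⇒Q-filter : ∀ {F} → IsFilter R F → D ⊆ F → IsFilter Q F
  filter⊇Ds⇒Q-filter F-filter D⊆F = record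
    { nonempty  = nonempty
    ; ⊙-closed  = ⊙-closed
    ; up-closed = λ x≤Qy Fx → up-closed x∧y≤y (F-mp Fx (up-closed x∧y≤y (D⊆F x≤Qy))) }
    where
    open IsFilter F-filter
    open FilterProps F-filter

  DsClosed : ∀ {ℓ} → Pred Carrier ℓ → Set _
  DsClosed X = ∀ {x a} → X x → x ≡D a → X a

  /Ds-self : ∀ {ℓ} {X : Pred Carrier ℓ} → DsClosed X → ∀ a → _/_ R X D a ⇔ X a
  /Ds-self X-closed a =
    mk⇔ (λ (x , Xx , x≡a) → X-closed Xx x≡a) (λ Xa → a , Xa , ≈⇒≡D refl)

  filter⊇Ds⇒DsClosed : ∀ {F} → IsFilter R F → D ⊆ F → DsClosed F
  filter⊇Ds⇒DsClosed F-filter D⊆F Fx x≡a =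
    F-mp Fx (IsFilter.up-closed F-filter x∧y≤x (D⊆F x≡a))
    where open FilterProps F-filter

  _∨ᶠ_ : Pred Carrier c → Pred Carrier c → Pred Carrier c
  (F ∨ᶠ G) x = Σ Carrier λ f → Σ Carrier λ g → F f × G g × ((f ⊙ g) ≤ x)

  ∨ᶠ-isFilter : ∀ {F G} → IsFilter R F → IsFilter R G → IsFilter R (F ∨ᶠ G)
  ∨ᶠ-isFilter F-filter G-filter = record
    { nonempty  = 1# , 1# , 1# , F.1∈F , G.1∈F , 1-greatest _
    ; ⊙-closed  = λ (f , g , Ff , Gg , fg≤x) (f′ , g′ , Ff′ , Gg′ , fg′≤y) →
        f ⊙ f′ , g ⊙ g′ , IsFilter.⊙-closed F-filter Ff Ff′ ,
        IsFilter.⊙-closed G-filter Gg Gg′ ,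
        ≤-trans (≈⇒≤ (interchange f f′ g g′)) (⊙-mono fg≤x fg′≤y)
    ; up-closed = λ x≤y (f , g , Ff , Gg , fg≤x) → f , g , Ff , Gg , ≤-trans fg≤x x≤y }
    where
    module F = FilterProps F-filter
    module G = FilterProps G-filter
    interchange : ∀ m m′ d d′ → ((m ⊙ m′) ⊙ (d ⊙ d′)) ≈ ((m ⊙ d) ⊙ (m′ ⊙ d′))
    interchange m m′ d d′ = trans (assoc m m′ (d ⊙ d′))
      (trans (∙-cong refl (sym (assoc m′ d d′)))
      (trans (∙-cong refl (∙-cong (comm m′ d) refl))
      (trans (∙-cong refl (assoc d m′ d′)) (sym (assoc m d (m′ ⊙ d′))))))

  -- Joining Ds(A) to a proper filter keeps it proper: f ⊙ d ≤ 0 gives f ≤ ¬d ≈ 0.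
  ∨ᶠDs-proper : ∀ {F} → IsProperFilter R F → ¬ (∀ x → (F ∨ᶠ D) x)
  ∨ᶠDs-proper (F-filter , F-proper) total with total 0#
  ... | f , d , Ff , Dd , fd≤0 = F-proper (0∈F⇒total F0)
    where
    open FilterProps F-filter
    F0 = IsFilter.up-closed F-filter (≤-trans (residual-intro fd≤0) (≈⇒≤ Dd)) Ff

  maximal⊇Ds : ∀ {M} → IsMaximal R M → D ⊆ M
  maximal⊇Ds {M} (M-prop@(M-filter , _) , maximality) Dd =
    maximality (M ∨ᶠ D) (∨ᶠ-isFilter M-filter Ds-isFilter , ∨ᶠDs-proper M-prop)
      (λ {m} Mm → m , 1# , Mm , 1∈Ds , ≈⇒≤ (identityʳ m))
      (1# , _ , 1∈M , Dd , ≈⇒≤ (identityˡ _))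
    where open FilterProps M-filter renaming (1∈F to 1∈M)

  maximalQ⇒maximal : ∀ {P} → IsMaximal Q P → IsMaximal R P
  maximalQ⇒maximal ((P-filter , P-proper) , maximality) =
    (Q-filter⇒filter P-filter , P-proper) ,
    λ G (G-filter , G-proper) P⊆G → maximality G
      (filter⊇Ds⇒Q-filter G-filter (λ Dd → P⊆G (Q-filter⊇Ds P-filter Dd)) , G-proper) P⊆G

  maximal⇒maximalQ : ∀ {N} → IsMaximal R N → IsMaximal Q N
  maximal⇒maximalQ N-max@((N-filter , N-proper) , maximality) =
    (filter⊇Ds⇒Q-filter N-filter (maximal⊇Ds N-max) , N-proper) ,
    λ G (G-filter , G-proper) N⊆G → maximality G (Q-filter⇒filter G-filter , G-proper) N⊆G

  maximal-DsClosed : ∀ {M} → IsMaximal R M → DsClosed M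
  maximal-DsClosed M-max = filter⊇Ds⇒DsClosed (proj₁ (proj₁ M-max)) (maximal⊇Ds M-max)

  RadQ⇔Rad : ∀ x → Rad Q x ⇔ Rad R x
  RadQ⇔Rad x = mk⇔ (λ r M M-max → r M (maximal⇒maximalQ M-max))
                   (λ r P P-max → r P (maximalQ⇒maximal P-max))

  Rad-DsClosed : DsClosed (Rad R)
  Rad-DsClosed r x≡a M M-max = maximal-DsClosed M-max (r M M-max) x≡a

  -- The identity on subsets is a homeomorphism Max(A) ≅ Max(Q): both Stone
  -- topologies are defined by the same sets S_Max(X).
  Max-homeomorphic : Homeomorphic R Q
  Max-homeomorphic = record
    { to        = toQ
    ; from      = fromQ
    ; to-cong   = λ M≐N → M≐N
    ; from-cong = λ M≐N → M≐N
    ; from∘to   = λ _ _ → ⇔.refl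
    ; to∘from   = λ _ _ → ⇔.refl
    ; to-continuous   = λ U (X , U⇔S) → X , λ M → U⇔S (toQ M)
    ; from-continuous = λ U (X , U⇔S) → X , λ N → U⇔S (fromQ N) }
    where
    toQ : Max R → Max Q
    toQ (M , M-max) = M , maximal⇒maximalQ M-max
    fromQ : Max Q → Max R
    fromQ (N , N-max) = N , maximalQ⇒maximal N-max

proposition3p1 : {c : Level} → ExcludedMiddle c → (A : ResLattice c) →
    let R = ResLattice.raw A
        Q = QuotDs A
        D = Ds R
    in
    -- (i)
    (∀ (M : _) → IsMaximal R M → ∀ a → (_/_ R M D) a ⇔ M a)
    -- (ii)
    × ((∀ P → IsMaximal Q P → ∃ λ N → IsMaximal R N × (∀ x → P x ⇔ (_/_ R N D) x))
       × (∀ N → IsMaximal R N → IsMaximal Q (_/_ R N D)))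
    -- (iii)
    × (∀ a → (_/_ R (Rad R) D) a ⇔ Rad R a)
    -- (iv)
    × (∀ x → Rad Q x ⇔ (_/_ R (Rad R) D) x)
    -- (v)
    × Homeomorphic R Q
proposition3p1 _ A =
    (λ M M-max → /Ds-self A (maximal-DsClosed A M-max))
  , ( (λ P P-max → P , maximalQ⇒maximal A P-max ,
         λ x → ⇔.sym (/Ds-self A (maximal-DsClosed A (maximalQ⇒maximal A P-max)) x))
    , (λ N N-max → IsMaximal-resp (QuotDs A)
         (λ x → ⇔.sym (/Ds-self A (maximal-DsClosed A N-max) x))
         (maximal⇒maximalQ A N-max)))
  , /Ds-self A (Rad-DsClosed A)
  , (λ x → ⇔.trans (RadQ⇔Rad A x) (⇔.sym (/Ds-self A (Rad-DsClosed A) x)))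
  , Max-homeomorphic A
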